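{- Let $G$ be a finite simple graph, with $(H,H')$ and $M$ as in the standing setting below. Then $P(M,H)=P_o^M(M,H)$, and every vertex lying on a path from $P(M,H)$ is incident to an edge of $H'$.
   Context: $\nu(G)$ is the maximum matching size. $B_2(G)$ is the set of pairs $(H,H')$ of edge-disjoint matchings; $\lambda_2(G)=\max\{|H|+|H'|:(H,H')\in B_2(G)\}$; $\alpha_2(G)=\max\{|H|,|H'|:(H,H')\in B_2(G),\ |H|+|H'|=\lambda_2(G)\}$; $M_2(G)=\{(H,H')\in B_2(G): |H|+|H'|=\lambda_2(G),\ |H|=\alpha_2(G)\}$. For matchings $A,B$: a path $e_1,\dots,e_l$ ($l\ge1$) is $A$-$B$ alternating if the edges with odd indices lie in $A\setminus B$ and the others in $B\setminus A$, or vice versa; it is maximal if it is not a proper subpath of another $A$-$B$ alternating path. $P(A,B)$ is the set of maximal $A$-$B$ alternating paths, and $P_o^A(A,B)$ those of odd length whose first edge is in $A$. Standing setting: over all $(H,H')\in M_2(G)$ and all maximum matchings $M$ of $G$, consider the triples maximizing $|M\cap H|$; among these, $((H,H'),M)$ is chosen to maximize $|M\cap H'|$. -}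

module Defs where

open import Data.Nat using (ℕ; _+_; _*_; _∸_; _≤_; _<_)
open import Data.Fin using (Fin; toℕ)
open import Data.Fin.Properties using (_≟_)
open import Data.Product using (Σ; ∃; _×_; _,_)
open import Data.Product.Properties using (≡-dec)
open import Data.Sum using (_⊎_)
open import Data.List using (List; []; _∷_; length; filter; _++_; reverse)
open import Data.List.Membership.Propositional using (_∈_)
open import Data.List.Membership.DecPropositional using () renaming (_∈?_ to ∈?-gen)
open import Data.List.Relation.Unary.All using (All)
open import Data.List.Relation.Unary.Unique.Propositional using (Unique)
open import Relation.Nullary using (¬_)
open import Relation.Binary.PropositionalEquality using (_≡_)

record SimpleGraph (n : ℕ) : Set₁ where
  field
    Adj    : Fin n → Fin n → Set
    sym    : ∀ {u v} → Adj u v → Adj v u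
    irrefl : ∀ {u} → ¬ Adj u u
open SimpleGraph public

-- An edge {u,v} is represented canonically by the ordered pair (u , v) with u < v.
Edge : ℕ → Set
Edge n = Fin n × Fin n

-- Sets of edges are duplicate-free lists of canonical edges.
EdgeSet : ℕ → Set
EdgeSet n = List (Edge n)

IsEdge : ∀ {n} → SimpleGraph n → Edge n → Set
IsEdge G (u , v) = (toℕ u < toℕ v) × Adj G u v

EdgeIn : ∀ {n} → Fin n → Fin n → EdgeSet n → Set
EdgeIn x y A = ((x , y) ∈ A) ⊎ ((y , x) ∈ A)

Incident : ∀ {n} → Fin n → Edge n → Set
Incident x (u , v) = (x ≡ u) ⊎ (x ≡ v)

VertexDisjoint : ∀ {n} → Edge n → Edge n → Set
VertexDisjoint (u , v) (u' , v') =
  ¬ (u ≡ u') × ¬ (u ≡ v') × ¬ (v ≡ u') × ¬ (v ≡ v')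

size : ∀ {n} → EdgeSet n → ℕ
size = length

_∩size_ : ∀ {n} → EdgeSet n → EdgeSet n → ℕ
A ∩size B = length (filter (λ e → ∈?-gen (≡-dec _≟_ _≟_) e B) A)

IsMatching : ∀ {n} → SimpleGraph n → EdgeSet n → Set
IsMatching G A =
  Unique A × All (IsEdge G) A ×
  (∀ e f → e ∈ A → f ∈ A → ¬ (e ≡ f) → VertexDisjoint e f)

IsMaximumMatching : ∀ {n} → SimpleGraph n → EdgeSet n → Set
IsMaximumMatching G M =
  IsMatching G M × (∀ N → IsMatching G N → size N ≤ size M)

InB2 : ∀ {n} → SimpleGraph n → EdgeSet n → EdgeSet n → Set
InB2 G H H' = IsMatching G H × IsMatching G H' × (∀ e → e ∈ H → ¬ (e ∈ H'))

IsMaxB2 : ∀ {n} → SimpleGraph n → EdgeSet n → EdgeSet n → Set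
IsMaxB2 G H H' =
  InB2 G H H' × (∀ K K' → InB2 G K K' → size K + size K' ≤ size H + size H')

InM2 : ∀ {n} → SimpleGraph n → EdgeSet n → EdgeSet n → Set
InM2 G H H' =
  IsMaxB2 G H H' ×
  (∀ K K' → IsMaxB2 G K K' → (size K ≤ size H) × (size K' ≤ size H))

StandingSetting : ∀ {n} → SimpleGraph n → EdgeSet n → EdgeSet n → EdgeSet n → Set
StandingSetting G H H' M =
  InM2 G H H' × IsMaximumMatching G M ×
  (∀ K K' N → InM2 G K K' → IsMaximumMatching G N → N ∩size K ≤ M ∩size H) ×
  (∀ K K' N → InM2 G K K' → IsMaximumMatching G N →
     N ∩size K ≡ M ∩size H → N ∩size K' ≤ M ∩size H')

-- A path is given by its list of vertices v₀ v₁ … v_l (l ≥ 1 edges).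
-- AltFrom A B p : the edges of p, in order, lie alternately in A ∖ B and
-- B ∖ A, starting with an edge in A ∖ B.
data AltFrom {n : ℕ} (A B : EdgeSet n) : List (Fin n) → Set where
  one  : ∀ {x y} → EdgeIn x y A → ¬ EdgeIn x y B → AltFrom A B (x ∷ y ∷ [])
  more : ∀ {x y z rest} → EdgeIn x y A → ¬ EdgeIn x y B →
         AltFrom B A (y ∷ z ∷ rest) → AltFrom A B (x ∷ y ∷ z ∷ rest)

IsAltPath : ∀ {n} → EdgeSet n → EdgeSet n → List (Fin n) → Set
IsAltPath A B p = Unique p × (AltFrom A B p ⊎ AltFrom B A p)

pathLength : ∀ {n} → List (Fin n) → ℕ
pathLength p = length p ∸ 1

ProperSubpath : ∀ {n} → List (Fin n) → List (Fin n) → Set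
ProperSubpath p q =
  ((∃ λ xs → ∃ λ ys → q ≡ xs ++ p ++ ys) ⊎
   (∃ λ xs → ∃ λ ys → reverse q ≡ xs ++ p ++ ys)) ×
  (length p < length q)

InP : ∀ {n} → EdgeSet n → EdgeSet n → List (Fin n) → Set
InP A B p = IsAltPath A B p × (∀ q → IsAltPath A B q → ¬ ProperSubpath p q)

OddNat : ℕ → Set
OddNat m = ∃ λ k → m ≡ 1 + 2 * k

InPoA : ∀ {n} → EdgeSet n → EdgeSet n → List (Fin n) → Set
InPoA A B p = InP A B p × OddNat (pathLength p) × AltFrom A B p

-- Both parts are exchange arguments against the extremal choice of ((H , H') , M).  Replacing,
-- on a vertex set S, the M-edges touching S by the H-edges within S yields a matching, still
-- maximum when the latter are at least as many, and meeting H in more edges when no edge of M ∩ H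
-- touches S and some H-edge lies within S; so such an S cannot exist.  The analogous exchange of
-- M into H' produces a pair (H , H'') still in M₂ with M ∩ H'' larger than M ∩ H'.  With
-- S = {a , b} this says that every endpoint of an H∖M edge is M-covered and every endpoint of an
-- M∖H edge is H'-covered.  If a maximal M-H alternating path began or ended with an H-edge,
-- maximality would force the M-edges at its ends back into the path, so M∖H would match the
-- path's vertices among themselves while H-edges within it cover all but one of them: a forbidden
-- S.  Hence maximal paths begin and end with M-edges, i.e. have odd length, and each of their
-- vertices is an endpoint of an M∖H edge.

module Submission where

open import Data.Empty using (⊥; ⊥-elim)
open import Data.Fin using (Fin)
open import Data.Fin.Properties using (_≟_)
open import Data.List using (List; []; _∷_; length; filter; _++_)
open import Data.List.Membership.Propositional using (_∈_; _∉_; lose)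
open import Data.List.Membership.Propositional.Properties
  using (∈-filter⁺; ∈-filter⁻; ∈-++⁺ˡ; ∈-++⁺ʳ; ∈-++⁻)
open import Data.List.Membership.DecPropositional using () renaming (_∈?_ to ∈-dec)
open import Data.List.Properties using (filter-some; filter-notAll; filter-++; length-++; ++-identityʳ)
open import Data.List.Relation.Unary.All as All using ([]; _∷_)
open import Data.List.Relation.Unary.AllPairs using ([]; _∷_)
open import Data.List.Relation.Unary.Any as Any using (Any; here; there; any?)
open import Data.List.Relation.Unary.Unique.Propositional using (Unique)
import Data.List.Relation.Unary.Unique.Propositional.Properties as Unique
open import Data.Nat using (ℕ; zero; suc; _+_; _*_; _≤_; _<_; z≤n; s≤s)
open import Data.Nat.Properties
  using (≤-trans; ≤-refl; <-irrefl; +-suc; +-comm; +-monoˡ-≤; +-monoʳ-≤;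
         m≤n⇒m≤1+n; ≤-pred; *-suc; m<m+n; ≤⇒≯; module ≤-Reasoning)
open import Data.Product using (Σ; ∃; _×_; _,_; proj₁; proj₂)
import Data.Product as Product
open import Data.Product.Properties using (≡-dec)
open import Data.Sum using (_⊎_; inj₁; inj₂; swap; map₂)
open import Function.Base using (_∘_)
open import Function.Bundles using (_⇔_; mk⇔)
open import Level using (0ℓ)
open import Relation.Binary.Definitions using (DecidableEquality)
open import Relation.Binary.PropositionalEquality using (_≡_; _≢_; refl; sym; trans; cong; subst)
open import Relation.Nullary using (yes; no; ¬_; ¬?)
open import Relation.Nullary.Decidable using (_⊎-dec_; _×-dec_)
open import Relation.Unary using (Pred; Decidable)
open import Relation.Unary.Properties using (∁?)
open import Defs hiding (sym; irrefl)

count : {A : Set} {P : Pred A 0ℓ} → Decidable P → List A → ℕ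
count P? xs = length (filter P? xs)

module _ {A : Set} where

  count-mono : {P Q : Pred A 0ℓ} (P? : Decidable P) (Q? : Decidable Q) (xs : List A) →
    (∀ {x} → x ∈ xs → P x → Q x) → count P? xs ≤ count Q? xs
  count-mono P? Q? [] P⇒Q = z≤n
  count-mono P? Q? (x ∷ xs) P⇒Q with P? x | Q? x | count-mono P? Q? xs (λ m → P⇒Q (there m))
  ... | yes p | yes q | ih = s≤s ih
  ... | yes p | no ¬q | ih = ⊥-elim (¬q (P⇒Q (here refl) p))
  ... | no ¬p | yes q | ih = m≤n⇒m≤1+n ih
  ... | no ¬p | no ¬q | ih = ih

  count-disjoint-+ : {P Q R : Pred A 0ℓ} (P? : Decidable P) (Q? : Decidable Q) (R? : Decidable R)
    (xs : List A) →
    (∀ {x} → x ∈ xs → Q x ⊎ R x → P x) → (∀ {x} → x ∈ xs → Q x → R x → ⊥) →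
    count Q? xs + count R? xs ≤ count P? xs
  count-disjoint-+ P? Q? R? [] _ _ = z≤n
  count-disjoint-+ P? Q? R? (x ∷ xs) Q∪R⇒P disj with P? x | Q? x | R? x
       | count-disjoint-+ P? Q? R? xs (λ m → Q∪R⇒P (there m)) (λ m → disj (there m))
  ... | _     | yes q | yes r | _  = ⊥-elim (disj (here refl) q r)
  ... | yes p | yes q | no ¬r | ih = s≤s ih
  ... | yes p | no ¬q | yes r | ih = subst (_≤ suc (count P? xs)) (sym (+-suc (count Q? xs) _)) (s≤s ih)
  ... | yes p | no ¬q | no ¬r | ih = m≤n⇒m≤1+n ih
  ... | no ¬p | yes q | no ¬r | _  = ⊥-elim (¬p (Q∪R⇒P (here refl) (inj₁ q)))
  ... | no ¬p | no ¬q | yes r | _  = ⊥-elim (¬p (Q∪R⇒P (here refl) (inj₂ r)))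
  ... | no ¬p | no ¬q | no ¬r | ih = ih

  length≡count+count∁ : {P : Pred A 0ℓ} (P? : Decidable P) (xs : List A) →
    length xs ≡ count P? xs + count (∁? P?) xs
  length≡count+count∁ P? [] = refl
  length≡count+count∁ P? (x ∷ xs) with P? x
  ... | yes _ = cong suc (length≡count+count∁ P? xs)
  ... | no _  = trans (cong suc (length≡count+count∁ P? xs)) (sym (+-suc (count P? xs) _))

  count-pos : {P : Pred A 0ℓ} (P? : Decidable P) {x : A} {xs : List A} → x ∈ xs → P x → 0 < count P? xs
  count-pos P? x∈xs px = filter-some P? (lose x∈xs px)

  count-≤-count-filter : {P Q : Pred A 0ℓ} (P? : Decidable P) (Q? : Decidable Q) (xs : List A) →
    (∀ {x} → x ∈ xs → P x → Q x) → count P? xs ≤ count P? (filter Q? xs)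
  count-≤-count-filter P? Q? [] _ = z≤n
  count-≤-count-filter P? Q? (x ∷ xs) P⇒Q with Q? x
  ... | yes q with P? x
  ...   | yes p = s≤s (count-≤-count-filter P? Q? xs (λ m → P⇒Q (there m)))
  ...   | no ¬p = count-≤-count-filter P? Q? xs (λ m → P⇒Q (there m))
  count-≤-count-filter P? Q? (x ∷ xs) P⇒Q | no ¬q with P? x
  ...   | yes p = ⊥-elim (¬q (P⇒Q (here refl) p))
  ...   | no ¬p = count-≤-count-filter P? Q? xs (λ m → P⇒Q (there m))

  count-++ : {P : Pred A 0ℓ} (P? : Decidable P) (xs ys : List A) →
    count P? (xs ++ ys) ≡ count P? xs + count P? ys
  count-++ P? xs ys = trans (cong length (filter-++ P? xs ys)) (length-++ (filter P? xs))

  length≤1 : {xs : List A} → Unique xs → (∀ {x y} → x ∈ xs → y ∈ xs → x ≡ y) → length xs ≤ 1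
  length≤1 {[]} _ _ = z≤n
  length≤1 {x ∷ []} _ _ = s≤s z≤n
  length≤1 {x ∷ y ∷ xs} ((x≢y ∷ _) ∷ _) all≡ = ⊥-elim (x≢y (all≡ (here refl) (there (here refl))))

  unique-⊆⇒length≤ : DecidableEquality A → {xs ys : List A} → Unique xs →
    (∀ {x} → x ∈ xs → x ∈ ys) → length xs ≤ length ys
  unique-⊆⇒length≤ _≟_ {[]} _ _ = z≤n
  unique-⊆⇒length≤ _≟_ {x ∷ xs} {ys} (x∉xs ∷ uxs) xs⊆ys =
    ≤-trans (s≤s (unique-⊆⇒length≤ _≟_ uxs xs⊆ys-x))
            (filter-notAll ≢x? ys (Any.map (λ { refl x≢x → x≢x refl }) (xs⊆ys (here refl))))
    where
    ≢x? : Decidable (x ≢_)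
    ≢x? y = ¬? (x ≟ y)
    xs⊆ys-x : ∀ {z} → z ∈ xs → z ∈ filter ≢x? ys
    xs⊆ys-x z∈xs = ∈-filter⁺ ≢x? (xs⊆ys (there z∈xs)) (All.lookup x∉xs z∈xs)

m+m≤1+h+h⇒m≤h : ∀ m h → m + m ≤ suc (h + h) → m ≤ h
m+m≤1+h+h⇒m≤h zero h _ = z≤n
m+m≤1+h+h⇒m≤h (suc m) zero le rewrite +-suc m m with le
... | s≤s ()
m+m≤1+h+h⇒m≤h (suc m) (suc h) le rewrite +-suc m m | +-suc h h =
  s≤s (m+m≤1+h+h⇒m≤h m h (≤-pred (≤-pred le)))

module _ {n : ℕ} where

  _≟ᴱ_ : DecidableEquality (Edge n)
  _≟ᴱ_ = ≡-dec _≟_ _≟_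

  -- A ∩size B unfolds to count (in? B) A.
  in? : (K : EdgeSet n) → Decidable (_∈ K)
  in? K e = ∈-dec _≟ᴱ_ e K

  Joins : Fin n → Fin n → Edge n → Set
  Joins x y f = (f ≡ (x , y)) ⊎ (f ≡ (y , x))

  edgeIn⇒joins : ∀ {x y A} → EdgeIn x y A → ∃ λ f → f ∈ A × Joins x y f
  edgeIn⇒joins (inj₁ m) = _ , m , inj₁ refl
  edgeIn⇒joins (inj₂ m) = _ , m , inj₂ refl

  joins⇒edgeIn : ∀ {x y f A} → f ∈ A → Joins x y f → EdgeIn x y A
  joins⇒edgeIn m (inj₁ refl) = inj₁ m
  joins⇒edgeIn m (inj₂ refl) = inj₂ m

  joins⇒incidentˡ : ∀ {x y f} → Joins x y f → Incident x f
  joins⇒incidentˡ (inj₁ refl) = inj₁ refl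
  joins⇒incidentˡ (inj₂ refl) = inj₂ refl

  joins⇒incidentʳ : ∀ {x y f} → Joins x y f → Incident y f
  joins⇒incidentʳ (inj₁ refl) = inj₂ refl
  joins⇒incidentʳ (inj₂ refl) = inj₁ refl

  incident? : (a : Fin n) → Decidable (Incident a)
  incident? a (u , v) = (a ≟ u) ⊎-dec (a ≟ v)

  covered⊎exposed : (A : EdgeSet n) (a : Fin n) →
    (∃ λ w → EdgeIn a w A) ⊎ (∀ {e} → e ∈ A → ¬ Incident a e)
  covered⊎exposed A a with any? (incident? a) A
  ... | yes a∈A = inj₁ (partner a∈A)
    where
    partner : ∀ {A} → Any (Incident a) A → ∃ λ w → EdgeIn a w A
    partner (here (inj₁ refl)) = _ , inj₁ (here refl)
    partner (here (inj₂ refl)) = _ , inj₂ (here refl)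
    partner (there a∈A) with partner a∈A
    ... | w , inj₁ m = w , inj₁ (there m)
    ... | w , inj₂ m = w , inj₂ (there m)
  ... | no a∉A = inj₂ (λ m i → a∉A (lose m i))

  Touch : List (Fin n) → Edge n → Set
  Touch S e = (proj₁ e ∈ S) ⊎ (proj₂ e ∈ S)

  Within : List (Fin n) → Edge n → Set
  Within S e = (proj₁ e ∈ S) × (proj₂ e ∈ S)

  touch? : (S : List (Fin n)) → Decidable (Touch S)
  touch? S e = ∈-dec _≟_ (proj₁ e) S ⊎-dec ∈-dec _≟_ (proj₂ e) S

  within? : (S : List (Fin n)) → Decidable (Within S)
  within? S e = ∈-dec _≟_ (proj₁ e) S ×-dec ∈-dec _≟_ (proj₂ e) S

  touch⇒incident : ∀ {S e} → Touch S e → ∃ λ z → z ∈ S × Incident z e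
  touch⇒incident (inj₁ m) = _ , m , inj₁ refl
  touch⇒incident (inj₂ m) = _ , m , inj₂ refl

  joins⇒within : ∀ {S x y f} → x ∈ S → y ∈ S → Joins x y f → Within S f
  joins⇒within x∈S y∈S (inj₁ refl) = x∈S , y∈S
  joins⇒within x∈S y∈S (inj₂ refl) = y∈S , x∈S

  within-incident⇒∈ : ∀ {S x e} → Within S e → Incident x e → x ∈ S
  within-incident⇒∈ (u∈S , v∈S) (inj₁ refl) = u∈S
  within-incident⇒∈ (u∈S , v∈S) (inj₂ refl) = v∈S

  within-¬touch⇒disjoint : ∀ {S} e f → Within S e → ¬ Touch S f → VertexDisjoint e f
  within-¬touch⇒disjoint _ _ (u∈S , v∈S) ¬t =
    (λ { refl → ¬t (inj₁ u∈S) }) , (λ { refl → ¬t (inj₂ u∈S) }) ,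
    (λ { refl → ¬t (inj₁ v∈S) }) , (λ { refl → ¬t (inj₂ v∈S) })

  ¬touch-within⇒disjoint : ∀ {S} e f → ¬ Touch S e → Within S f → VertexDisjoint e f
  ¬touch-within⇒disjoint _ _ ¬t (u∈S , v∈S) =
    (λ { refl → ¬t (inj₁ u∈S) }) , (λ { refl → ¬t (inj₁ v∈S) }) ,
    (λ { refl → ¬t (inj₂ u∈S) }) , (λ { refl → ¬t (inj₂ v∈S) })

  endpoints : EdgeSet n → List (Fin n)
  endpoints [] = []
  endpoints ((u , v) ∷ es) = u ∷ v ∷ endpoints es

  length-endpoints : ∀ es → length (endpoints es) ≡ length es + length es
  length-endpoints [] = refl
  length-endpoints ((u , v) ∷ es) =
    cong suc (trans (cong suc (length-endpoints es)) (sym (+-suc _ _)))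

  incident⇒∈endpoints : ∀ {x e es} → e ∈ es → Incident x e → x ∈ endpoints es
  incident⇒∈endpoints {es = _ ∷ _} (here refl) (inj₁ refl) = here refl
  incident⇒∈endpoints {es = _ ∷ _} (here refl) (inj₂ refl) = there (here refl)
  incident⇒∈endpoints {es = _ ∷ _} (there m) i = there (there (incident⇒∈endpoints m i))

  ∈endpoints⇒incident : ∀ {x} es → x ∈ endpoints es → ∃ λ e → e ∈ es × Incident x e
  ∈endpoints⇒incident (_ ∷ es) (here refl) = _ , here refl , inj₁ refl
  ∈endpoints⇒incident (_ ∷ es) (there (here refl)) = _ , here refl , inj₂ refl
  ∈endpoints⇒incident (_ ∷ es) (there (there m)) with ∈endpoints⇒incident es m
  ... | e , e∈es , i = e , there e∈es , i

  length≤1+double-count-within : ∀ {B S} (o : Fin n) → Unique S →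
    (∀ {z} → z ∈ S → z ≢ o → ∃ λ y → y ∈ S × EdgeIn z y B) →
    length S ≤ suc (count (within? S) B + count (within? S) B)
  length≤1+double-count-within {B} {S} o S-unique partner =
    subst (λ k → length S ≤ suc k) (length-endpoints (filter (within? S) B))
      (unique-⊆⇒length≤ _≟_ S-unique ⊆o∷endpoints)
    where
    ⊆o∷endpoints : ∀ {z} → z ∈ S → z ∈ o ∷ endpoints (filter (within? S) B)
    ⊆o∷endpoints {z} z∈S with z ≟ o
    ... | yes z≡o = here z≡o
    ... | no z≢o with partner z∈S z≢o
    ...   | y , y∈S , zy with edgeIn⇒joins zy
    ...     | f , f∈B , joins = there (incident⇒∈endpoints
                                  (∈-filter⁺ (within? S) f∈B (joins⇒within z∈S y∈S joins))
                                  (joins⇒incidentˡ joins))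

  vertexDisjoint⇒¬shared : ∀ {e f : Edge n} {x} → VertexDisjoint e f → Incident x e → Incident x f → ⊥
  vertexDisjoint⇒¬shared (u≢u' , _ , _ , _) (inj₁ refl) (inj₁ refl) = u≢u' refl
  vertexDisjoint⇒¬shared (_ , u≢v' , _ , _) (inj₁ refl) (inj₂ refl) = u≢v' refl
  vertexDisjoint⇒¬shared (_ , _ , v≢u' , _) (inj₂ refl) (inj₁ refl) = v≢u' refl
  vertexDisjoint⇒¬shared (_ , _ , _ , v≢v') (inj₂ refl) (inj₂ refl) = v≢v' refl

  exchange : List (Fin n) → EdgeSet n → EdgeSet n → EdgeSet n
  exchange S A B = filter (∁? (touch? S)) A ++ filter (within? S) B

  exchange-size : ∀ S A B → count (touch? S) A ≤ count (within? S) B → size A ≤ size (exchange S A B)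
  exchange-size S A B touchA≤withinB = begin
    length A                                      ≡⟨ length≡count+count∁ (touch? S) A ⟩
    count (touch? S) A + count (∁? (touch? S)) A  ≤⟨ +-monoˡ-≤ _ touchA≤withinB ⟩
    count (within? S) B + count (∁? (touch? S)) A ≡⟨ +-comm (count (within? S) B) _ ⟩
    count (∁? (touch? S)) A + count (within? S) B ≡⟨ sym (length-++ (filter (∁? (touch? S)) A)) ⟩
    size (exchange S A B)                         ∎
    where open ≤-Reasoning

  module _ (S : List (Fin n)) {A B : EdgeSet n}
           (A∩B-avoids-S : ∀ {f} → f ∈ A → f ∈ B → ¬ Touch S f)
           {e : Edge n} (e∈B : e ∈ B) (e-within-S : Within S e) where

    private
      A∖S B[S] : EdgeSet n
      A∖S = filter (∁? (touch? S)) A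
      B[S] = filter (within? S) B

      e∈B[S] : e ∈ B[S]
      e∈B[S] = ∈-filter⁺ (within? S) e∈B e-within-S

      parts⊆exchange : ∀ {f} → f ∈ B → f ∈ A∖S ⊎ f ∈ B[S] → f ∈ exchange S A B
      parts⊆exchange _ (inj₁ f∈A∖S) = ∈-++⁺ˡ f∈A∖S
      parts⊆exchange _ (inj₂ f∈B[S]) = ∈-++⁺ʳ A∖S f∈B[S]

      parts-disjoint : ∀ {f} → f ∈ B → f ∈ A∖S → f ∈ B[S] → ⊥
      parts-disjoint _ f∈A∖S f∈B[S] =
        proj₂ (∈-filter⁻ (∁? (touch? S)) {xs = A} f∈A∖S)
          (inj₁ (proj₁ (proj₂ (∈-filter⁻ (within? S) {xs = B} f∈B[S]))))

    exchange-gainˡ : A ∩size B < exchange S A B ∩size B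
    exchange-gainˡ = begin-strict
      count (in? B) A                        ≤⟨ count-≤-count-filter (in? B) (∁? (touch? S)) A A∩B-avoids-S ⟩
      count (in? B) A∖S                      <⟨ m<m+n _ (count-pos (in? B) e∈B[S] e∈B) ⟩
      count (in? B) A∖S + count (in? B) B[S] ≡⟨ sym (count-++ (in? B) A∖S B[S]) ⟩
      exchange S A B ∩size B                 ∎
      where open ≤-Reasoning

    exchange-gainʳ : B ∩size A < B ∩size exchange S A B
    exchange-gainʳ = begin-strict
      count (in? A) B                        ≤⟨ count-mono (in? A) (in? A∖S) B (λ f∈B f∈A →
                                                  ∈-filter⁺ (∁? (touch? S)) f∈A (A∩B-avoids-S f∈A f∈B)) ⟩
      count (in? A∖S) B                      <⟨ m<m+n _ (count-pos (in? B[S]) e∈B e∈B[S]) ⟩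
      count (in? A∖S) B + count (in? B[S]) B ≤⟨ count-disjoint-+ (in? (exchange S A B)) (in? A∖S) (in? B[S]) B
                                                  parts⊆exchange parts-disjoint ⟩
      B ∩size exchange S A B                 ∎
      where open ≤-Reasoning

module _ {n : ℕ} {G : SimpleGraph n} {A : EdgeSet n} (A-matching : IsMatching G A) where

  private
    A-disjoint : ∀ e f → e ∈ A → f ∈ A → e ≢ f → VertexDisjoint e f
    A-disjoint = proj₂ (proj₂ A-matching)

  matching-incident-unique : ∀ {e f x} → e ∈ A → f ∈ A → Incident x e → Incident x f → e ≡ f
  matching-incident-unique {e} {f} e∈A f∈A x∈e x∈f with e ≟ᴱ f
  ... | yes e≡f = e≡f
  ... | no e≢f = ⊥-elim (vertexDisjoint⇒¬shared (A-disjoint e f e∈A f∈A e≢f) x∈e x∈f)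

  matching-partner-unique : ∀ {z y y'} → EdgeIn z y A → EdgeIn z y' A → y ≡ y'
  matching-partner-unique {z} {y} {y'} zy zy' with edgeIn⇒joins zy | edgeIn⇒joins zy'
  ... | f , f∈A , joins | f' , f'∈A , joins' =
    other-ends joins joins'
      (matching-incident-unique f∈A f'∈A (joins⇒incidentˡ joins) (joins⇒incidentˡ joins'))
    where
    other-ends : ∀ {f f'} → Joins z y f → Joins z y' f' → f ≡ f' → y ≡ y'
    other-ends (inj₁ refl) (inj₁ refl) eq = cong proj₂ eq
    other-ends (inj₁ refl) (inj₂ refl) eq = trans (cong proj₂ eq) (cong proj₁ eq)
    other-ends (inj₂ refl) (inj₁ refl) eq = trans (cong proj₁ eq) (cong proj₂ eq)
    other-ends (inj₂ refl) (inj₂ refl) eq = cong proj₁ eq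

  count-touch-pair≤1 : ∀ {a b} → (∀ {e} → e ∈ A → ¬ Incident a e) → count (touch? (a ∷ b ∷ [])) A ≤ 1
  count-touch-pair≤1 {a} {b} a-exposed =
    length≤1 (Unique.filter⁺ (touch? _) (proj₁ A-matching)) λ e∈ f∈ →
      let e∈A , e-touch = ∈-filter⁻ (touch? _) {xs = A} e∈
          f∈A , f-touch = ∈-filter⁻ (touch? _) {xs = A} f∈
      in matching-incident-unique e∈A f∈A (at-b e∈A e-touch) (at-b f∈A f-touch)
    where
    at-b : ∀ {e} → e ∈ A → Touch (a ∷ b ∷ []) e → Incident b e
    at-b e∈A (inj₁ (here refl)) = ⊥-elim (a-exposed e∈A (inj₁ refl))
    at-b e∈A (inj₁ (there (here refl))) = inj₁ refl
    at-b e∈A (inj₂ (here refl)) = ⊥-elim (a-exposed e∈A (inj₂ refl))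
    at-b e∈A (inj₂ (there (here refl))) = inj₂ refl

  endpoints-unique : Unique (endpoints A)
  endpoints-unique = go A (proj₁ A-matching) (All.lookup (proj₁ (proj₂ A-matching))) A-disjoint
    where
    go : ∀ es → Unique es → (∀ {e} → e ∈ es → IsEdge G e) →
         (∀ e f → e ∈ es → f ∈ es → e ≢ f → VertexDisjoint e f) → Unique (endpoints es)
    go [] _ _ _ = []
    go ((u , v) ∷ es) (uv∉es ∷ es-unique) es-edges es-disjoint =
      (u≢v ∷ All.tabulate (apart (inj₁ refl))) ∷ All.tabulate (apart (inj₂ refl)) ∷
      go es es-unique (λ m → es-edges (there m)) (λ e f e∈ f∈ → es-disjoint e f (there e∈) (there f∈))
      where
      u≢v : u ≢ v
      u≢v refl = <-irrefl refl (proj₁ (es-edges (here refl)))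
      apart : ∀ {w x} → Incident w (u , v) → x ∈ endpoints es → w ≢ x
      apart w∈uv x∈ refl with ∈endpoints⇒incident es x∈
      ... | f , f∈es , x∈f =
        vertexDisjoint⇒¬shared (es-disjoint _ f (here refl) (there f∈es) (All.lookup uv∉es f∈es)) w∈uv x∈f

module _ {n : ℕ} {G : SimpleGraph n} where

  filter-isMatching : ∀ {A} {P : Pred (Edge n) 0ℓ} (P? : Decidable P) →
    IsMatching G A → IsMatching G (filter P? A)
  filter-isMatching {A} P? (A-unique , A-edges , A-disjoint) =
    Unique.filter⁺ P? A-unique ,
    All.tabulate (λ m → All.lookup A-edges (from m)) ,
    (λ e f e∈ f∈ → A-disjoint e f (from e∈) (from f∈))
    where
    from : ∀ {e} → e ∈ filter P? A → e ∈ A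
    from m = proj₁ (∈-filter⁻ P? {xs = A} m)

  exchange-isMatching : ∀ {A B} S → IsMatching G A → IsMatching G B → IsMatching G (exchange S A B)
  exchange-isMatching {A} {B} S (A-unique , A-edges , A-disjoint) (B-unique , B-edges , B-disjoint) =
    Unique.++⁺ (Unique.filter⁺ (∁? (touch? S)) A-unique) (Unique.filter⁺ (within? S) B-unique)
      (λ { (e∈A∖S , e∈B[S]) → proj₂ (fromA e∈A∖S) (inj₁ (proj₁ (proj₂ (fromB e∈B[S])))) }) ,
    All.tabulate edge , disjoint
    where
    fromA : ∀ {e} → e ∈ filter (∁? (touch? S)) A → e ∈ A × ¬ Touch S e
    fromA = ∈-filter⁻ (∁? (touch? S)) {xs = A}
    fromB : ∀ {e} → e ∈ filter (within? S) B → e ∈ B × Within S e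
    fromB = ∈-filter⁻ (within? S) {xs = B}
    edge : ∀ {e} → e ∈ exchange S A B → IsEdge G e
    edge m with ∈-++⁻ (filter (∁? (touch? S)) A) m
    ... | inj₁ e∈A∖S = All.lookup A-edges (proj₁ (fromA e∈A∖S))
    ... | inj₂ e∈B[S] = All.lookup B-edges (proj₁ (fromB e∈B[S]))
    disjoint : ∀ e f → e ∈ exchange S A B → f ∈ exchange S A B → e ≢ f → VertexDisjoint e f
    disjoint e f e∈ f∈ e≢f with ∈-++⁻ (filter (∁? (touch? S)) A) e∈ | ∈-++⁻ (filter (∁? (touch? S)) A) f∈
    ... | inj₁ e∈A∖S | inj₁ f∈A∖S = A-disjoint e f (proj₁ (fromA e∈A∖S)) (proj₁ (fromA f∈A∖S)) e≢f
    ... | inj₂ e∈B[S] | inj₂ f∈B[S] = B-disjoint e f (proj₁ (fromB e∈B[S])) (proj₁ (fromB f∈B[S])) e≢f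
    ... | inj₁ e∈A∖S | inj₂ f∈B[S] = ¬touch-within⇒disjoint e f (proj₂ (fromA e∈A∖S)) (proj₂ (fromB f∈B[S]))
    ... | inj₂ e∈B[S] | inj₁ f∈A∖S = within-¬touch⇒disjoint e f (proj₂ (fromB e∈B[S])) (proj₂ (fromA f∈A∖S))

  double-count-touch≤length : ∀ {A S} → IsMatching G A → (∀ {e} → e ∈ A → Touch S e → Within S e) →
    count (touch? S) A + count (touch? S) A ≤ length S
  double-count-touch≤length {A} {S} A-matching touch⇒within =
    subst (_≤ length S) (length-endpoints (filter (touch? S) A))
      (unique-⊆⇒length≤ _≟_ (endpoints-unique {G = G} (filter-isMatching (touch? S) A-matching)) ⊆S)
    where
    ⊆S : ∀ {x} → x ∈ endpoints (filter (touch? S) A) → x ∈ S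
    ⊆S x∈ with ∈endpoints⇒incident (filter (touch? S) A) x∈
    ... | e , e∈ , x∈e with ∈-filter⁻ (touch? S) {xs = A} e∈
    ...   | e∈A , e-touch = within-incident⇒∈ (touch⇒within e∈A e-touch) x∈e

module _ {n : ℕ} where

  Partner : EdgeSet n → EdgeSet n → Fin n → List (Fin n) → Set
  Partner A B z p = ∃ λ y → y ∈ p × EdgeIn z y A × ¬ EdgeIn z y B

  partner-there : ∀ {A B z w p} → Partner A B z p → Partner A B z (w ∷ p)
  partner-there (y , y∈p , zy∈A , zy∉B) = y , there y∈p , zy∈A , zy∉B

  last : ∀ {A B p} → AltFrom A B p → Fin n
  last (one {y = y} _ _) = y
  last (more _ _ r) = last r

  last∈ : ∀ {A B p} (d : AltFrom A B p) → last d ∈ p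
  last∈ (one _ _) = there (here refl)
  last∈ (more _ _ r) = there (last∈ r)

  head-partner : ∀ {A B x xs} → AltFrom A B (x ∷ xs) → Partner A B x (x ∷ xs)
  head-partner (one xy∈A xy∉B) = _ , there (here refl) , xy∈A , xy∉B
  head-partner (more xy∈A xy∉B _) = _ , there (here refl) , xy∈A , xy∉B

  alt-cons : ∀ {A B : EdgeSet n} {w x xs} → AltFrom B A (x ∷ xs) → EdgeIn w x A → ¬ EdgeIn w x B →
    AltFrom A B (w ∷ x ∷ xs)
  alt-cons d@(one _ _) wx∈A wx∉B = more wx∈A wx∉B d
  alt-cons d@(more _ _ _) wx∈A wx∉B = more wx∈A wx∉B d

  EndsWith : ∀ {A B p} (X Y : EdgeSet n) → AltFrom A B p → Set
  EndsWith {A} {B} {p} X Y d =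
    Partner X Y (last d) p ×
    (∀ {s} → EdgeIn (last d) s Y → ¬ EdgeIn (last d) s X → AltFrom A B (p ++ s ∷ []))

  endsWith-more : ∀ {A B X Y x y z rest} (xy∈A : EdgeIn x y A) (xy∉B : ¬ EdgeIn x y B)
    (r : AltFrom B A (y ∷ z ∷ rest)) → EndsWith X Y r → EndsWith X Y (more xy∈A xy∉B r)
  endsWith-more xy∈A xy∉B r (partner , extend) =
    partner-there partner , λ e ¬e → more xy∈A xy∉B (extend e ¬e)

  EvenNat : ℕ → Set
  EvenNat m = ∃ λ k → m ≡ 2 * k

  parity : ∀ {A B p} (d : AltFrom A B p) →
    (OddNat (pathLength p) × EndsWith A B d) ⊎ (EvenNat (pathLength p) × EndsWith B A d)
  parity (one xy∈A xy∉B) =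
    inj₁ ((0 , refl) , (_ , here refl , swap xy∈A , xy∉B ∘ swap) ,
          λ e ¬e → more xy∈A xy∉B (one e ¬e))
  parity (more xy∈A xy∉B r) with parity r
  ... | inj₁ ((k , odd) , ends) =
    inj₂ ((suc k , trans (cong suc odd) (sym (*-suc 2 k))) , endsWith-more xy∈A xy∉B r ends)
  ... | inj₂ ((k , even) , ends) = inj₁ ((k , cong suc even) , endsWith-more xy∈A xy∉B r ends)

  vertex-kinds : ∀ {A B x xs z} (d : AltFrom A B (x ∷ xs)) → z ∈ x ∷ xs →
    z ≡ x ⊎ z ≡ last d ⊎ (Partner A B z (x ∷ xs) × Partner B A z (x ∷ xs))
  vertex-kinds (one _ _) (here z≡x) = inj₁ z≡x
  vertex-kinds (one _ _) (there (here z≡y)) = inj₂ (inj₁ z≡y)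
  vertex-kinds (more _ _ _) (here z≡x) = inj₁ z≡x
  vertex-kinds (more xy∈A xy∉B r) (there z∈r) with vertex-kinds r z∈r
  ... | inj₁ refl = inj₂ (inj₂ ((_ , here refl , swap xy∈A , xy∉B ∘ swap) ,
                                partner-there (head-partner r)))
  ... | inj₂ (inj₁ z≡last) = inj₂ (inj₁ z≡last)
  ... | inj₂ (inj₂ (BA , AB)) = inj₂ (inj₂ (partner-there AB , partner-there BA))

  Maximal : EdgeSet n → EdgeSet n → List (Fin n) → Set
  Maximal A B p = ∀ q → IsAltPath A B q → ¬ ProperSubpath p q

  maximal-cons : ∀ {A B w p} → Maximal A B p → w ∉ p → Unique p →
    AltFrom A B (w ∷ p) ⊎ AltFrom B A (w ∷ p) → ⊥
  maximal-cons {w = w} {p} max w∉p p-unique alt =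
    max (w ∷ p) (All.tabulate (λ w'∈p w≡w' → w∉p (subst (_∈ p) (sym w≡w') w'∈p)) ∷ p-unique , alt)
        (inj₁ (w ∷ [] , [] , cong (w ∷_) (sym (++-identityʳ p))) , ≤-refl)

  maximal-snoc : ∀ {A B s p} → Maximal A B p → s ∉ p → Unique p →
    AltFrom A B (p ++ s ∷ []) ⊎ AltFrom B A (p ++ s ∷ []) → ⊥
  maximal-snoc {s = s} {p} max s∉p p-unique alt =
    max (p ++ s ∷ []) (Unique.++⁺ p-unique ([] ∷ []) (λ { (s∈p , here refl) → s∉p s∈p }) , alt)
        (inj₁ ([] , s ∷ [] , refl) ,
         subst (suc (length p) ≤_) (sym (trans (length-++ p) (+-comm (length p) 1))) ≤-refl)

module Standing {n : ℕ} {G : SimpleGraph n} {H H' M : EdgeSet n} (st : StandingSetting G H H' M) where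

  private
    H,H'∈M₂ : InM2 G H H'
    H,H'∈M₂ = proj₁ st

    H,H'∈B₂ : InB2 G H H'
    H,H'∈B₂ = proj₁ (proj₁ H,H'∈M₂)

    M-maximum : IsMaximumMatching G M
    M-maximum = proj₁ (proj₂ st)

    λ₂-attained : ∀ K K' → InB2 G K K' → size K + size K' ≤ size H + size H'
    λ₂-attained = proj₂ (proj₁ H,H'∈M₂)

    H∩H'-empty : ∀ e → e ∈ H → ¬ e ∈ H'
    H∩H'-empty = proj₂ (proj₂ H,H'∈B₂)

    M∩H-maximal : ∀ K K' N → InM2 G K K' → IsMaximumMatching G N → N ∩size K ≤ M ∩size H
    M∩H-maximal = proj₁ (proj₂ (proj₂ st))

    M∩H'-maximal : ∀ K K' N → InM2 G K K' → IsMaximumMatching G N →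
      N ∩size K ≡ M ∩size H → N ∩size K' ≤ M ∩size H'
    M∩H'-maximal = proj₂ (proj₂ (proj₂ st))

  H-matching : IsMatching G H
  H-matching = proj₁ H,H'∈B₂

  H'-matching : IsMatching G H'
  H'-matching = proj₁ (proj₂ H,H'∈B₂)

  M-matching : IsMatching G M
  M-matching = proj₁ M-maximum

  no-exchange-gaining-H : ∀ S → count (touch? S) M ≤ count (within? S) H →
    (∀ {f} → f ∈ M → f ∈ H → ¬ Touch S f) → ∀ {e} → e ∈ H → Within S e → ⊥
  no-exchange-gaining-H S bound M∩H-avoids-S e∈H e-within =
    ≤⇒≯ (M∩H-maximal H H' N H,H'∈M₂ N-maximum)
        (exchange-gainˡ S M∩H-avoids-S e∈H e-within)
    where
    N : EdgeSet n
    N = exchange S M H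
    N-maximum : IsMaximumMatching G N
    N-maximum = exchange-isMatching {G = G} S M-matching H-matching ,
                λ K K-matching → ≤-trans (proj₂ M-maximum K K-matching) (exchange-size S M H bound)

  no-exchange-gaining-H' : ∀ S → count (touch? S) H' ≤ count (within? S) M →
    (∀ {f} → f ∈ M → f ∈ H → ¬ Touch S f) → (∀ {f} → f ∈ H' → f ∈ M → ¬ Touch S f) →
    ∀ {e} → e ∈ M → Within S e → ⊥
  no-exchange-gaining-H' S bound M∩H-avoids-S H'∩M-avoids-S e∈M e-within =
    ≤⇒≯ (M∩H'-maximal H N M H,N∈M₂ M-maximum refl)
        (exchange-gainʳ S H'∩M-avoids-S e∈M e-within)
    where
    N : EdgeSet n
    N = exchange S H' M
    H∩N-empty : ∀ f → f ∈ H → ¬ f ∈ N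
    H∩N-empty f f∈H f∈N with ∈-++⁻ (filter (∁? (touch? S)) H') f∈N
    ... | inj₁ f∈H'∖S = H∩H'-empty f f∈H (proj₁ (∈-filter⁻ (∁? (touch? S)) {xs = H'} f∈H'∖S))
    ... | inj₂ f∈M[S] with ∈-filter⁻ (within? S) {xs = M} f∈M[S]
    ...   | f∈M , f-within = M∩H-avoids-S f∈M f∈H (inj₁ (proj₁ f-within))
    H,N∈M₂ : InM2 G H N
    H,N∈M₂ = ((H-matching , exchange-isMatching {G = G} S H'-matching M-matching , H∩N-empty) ,
               λ K K' K,K'∈B₂ → ≤-trans (λ₂-attained K K' K,K'∈B₂)
                                        (+-monoʳ-≤ (size H) (exchange-size S H' M bound))) ,
             proj₂ H,H'∈M₂

  M-covers-H∖M-endpoint : ∀ {a b} → EdgeIn a b H → ¬ EdgeIn a b M → ∃ λ w → EdgeIn a w M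
  M-covers-H∖M-endpoint {a} {b} ab∈H ab∉M with covered⊎exposed M a
  ... | inj₁ a-covered = a-covered
  ... | inj₂ a-exposed with edgeIn⇒joins ab∈H
  ...   | g , g∈H , joins = ⊥-elim (no-exchange-gaining-H S bound M∩H-avoids-S g∈H g-within)
    where
    S : List (Fin n)
    S = a ∷ b ∷ []
    g-within : Within S g
    g-within = joins⇒within (here refl) (there (here refl)) joins
    bound : count (touch? S) M ≤ count (within? S) H
    bound = ≤-trans (count-touch-pair≤1 {G = G} M-matching a-exposed) (count-pos (within? S) g∈H g-within)
    M∩H-avoids-S : ∀ {f} → f ∈ M → f ∈ H → ¬ Touch S f
    M∩H-avoids-S f∈M f∈H f-touch with touch⇒incident f-touch
    ... | _ , here refl , a∈f = a-exposed f∈M a∈f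
    ... | _ , there (here refl) , b∈f =
      ab∉M (joins⇒edgeIn (subst (_∈ M) (matching-incident-unique {G = G} H-matching f∈H g∈H b∈f
                                          (joins⇒incidentʳ joins)) f∈M) joins)

  H'-covers-M∖H-endpoint : ∀ {a b} → EdgeIn a b M → ¬ EdgeIn a b H → ∃ λ e → e ∈ H' × Incident a e
  H'-covers-M∖H-endpoint {a} {b} ab∈M ab∉H with covered⊎exposed H' a
  ... | inj₁ (w , aw∈H') with edgeIn⇒joins aw∈H'
  ...   | f , f∈H' , joins = f , f∈H' , joins⇒incidentˡ joins
  H'-covers-M∖H-endpoint {a} {b} ab∈M ab∉H | inj₂ a-exposed with edgeIn⇒joins ab∈M
  ...   | f , f∈M , joins = ⊥-elim (no-exchange-gaining-H' S bound M∩H-avoids-S H'∩M-avoids-S f∈M f-within)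
    where
    S : List (Fin n)
    S = a ∷ b ∷ []
    f-within : Within S f
    f-within = joins⇒within (here refl) (there (here refl)) joins
    bound : count (touch? S) H' ≤ count (within? S) M
    bound = ≤-trans (count-touch-pair≤1 {G = G} H'-matching a-exposed) (count-pos (within? S) f∈M f-within)
    only-f : ∀ {x} → x ∈ M → Touch S x → x ≡ f
    only-f x∈M x-touch with touch⇒incident x-touch
    ... | _ , here refl , a∈x =
      matching-incident-unique {G = G} M-matching x∈M f∈M a∈x (joins⇒incidentˡ joins)
    ... | _ , there (here refl) , b∈x =
      matching-incident-unique {G = G} M-matching x∈M f∈M b∈x (joins⇒incidentʳ joins)
    M∩H-avoids-S : ∀ {x} → x ∈ M → x ∈ H → ¬ Touch S x
    M∩H-avoids-S x∈M x∈H x-touch = ab∉H (joins⇒edgeIn (subst (_∈ H) (only-f x∈M x-touch) x∈H) joins)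
    H'∩M-avoids-S : ∀ {x} → x ∈ H' → x ∈ M → ¬ Touch S x
    H'∩M-avoids-S x∈H' x∈M x-touch =
      a-exposed (subst (_∈ H') (only-f x∈M x-touch) x∈H') (joins⇒incidentˡ joins)

  -- 2·#(M-edges touching S) ≤ |S| ≤ 1 + 2·#(H-edges within S), so exchanging M for H on S
  -- does not shrink M, and it gains the H-edge zy.
  no-M∖H-perfect-H-near-perfect-set : ∀ {S} → Unique S → (∀ {z} → z ∈ S → Partner M H z S) →
    (o : Fin n) → (∀ {z} → z ∈ S → z ≢ o → ∃ λ y → y ∈ S × EdgeIn z y H) →
    ∀ {z y} → z ∈ S → y ∈ S → EdgeIn z y H → ⊥
  no-M∖H-perfect-H-near-perfect-set {S} S-unique M-partner o H-partner z∈S y∈S zy∈H with edgeIn⇒joins zy∈H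
  ... | g , g∈H , joins =
    no-exchange-gaining-H S bound (λ f∈M f∈H f-touch → proj₂ (M-touch f∈M f-touch) f∈H)
      g∈H (joins⇒within z∈S y∈S joins)
    where
    M-touch : ∀ {f} → f ∈ M → Touch S f → Within S f × f ∉ H
    M-touch {f} f∈M f-touch with touch⇒incident f-touch
    ... | x , x∈S , x∈f with M-partner x∈S
    ...   | y , y∈S , xy∈M , xy∉H with edgeIn⇒joins xy∈M
    ...     | f' , f'∈M , joins' =
      subst (Within S) (sym f≡f') (joins⇒within x∈S y∈S joins') ,
      λ f∈H → xy∉H (joins⇒edgeIn (subst (_∈ H) f≡f' f∈H) joins')
      where
      f≡f' : f ≡ f'
      f≡f' = matching-incident-unique {G = G} M-matching f∈M f'∈M x∈f (joins⇒incidentˡ joins')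
    bound : count (touch? S) M ≤ count (within? S) H
    bound = m+m≤1+h+h⇒m≤h _ _
      (≤-trans (double-count-touch≤length {G = G} M-matching
                 (λ f∈M f-touch → proj₁ (M-touch f∈M f-touch)))
               (length≤1+double-count-within o S-unique H-partner))

  Blocked : List (Fin n) → Fin n → Set
  Blocked p a = ∀ {w} → w ∉ p → EdgeIn a w M → ¬ EdgeIn a w H → ⊥

  M-edge-at-H∖M-endpoint∉H : ∀ {a y w} → EdgeIn a y H → ¬ EdgeIn a y M → EdgeIn a w M → ¬ EdgeIn a w H
  M-edge-at-H∖M-endpoint∉H ay∈H ay∉M aw∈M aw∈H =
    ay∉M (subst (λ x → EdgeIn _ x M) (matching-partner-unique {G = G} H-matching aw∈H ay∈H) aw∈M)

  M∖H-partner-of-blocked : ∀ {p a} → Partner H M a p → Blocked p a → Partner M H a p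
  M∖H-partner-of-blocked {p} (y , _ , ay∈H , ay∉M) blocked with M-covers-H∖M-endpoint ay∈H ay∉M
  ... | w , aw∈M with ∈-dec _≟_ w p
  ...   | yes w∈p = w , w∈p , aw∈M , M-edge-at-H∖M-endpoint∉H ay∈H ay∉M aw∈M
  ...   | no w∉p = ⊥-elim (blocked w∉p aw∈M (M-edge-at-H∖M-endpoint∉H ay∈H ay∉M aw∈M))

  Settled : List (Fin n) → Fin n → Set
  Settled p z = Partner M H z p ⊎ (Partner H M z p × Blocked p z)

  settled⇒M∖H-partner : ∀ {p z} → Settled p z → Partner M H z p
  settled⇒M∖H-partner (inj₁ partner) = partner
  settled⇒M∖H-partner (inj₂ (partner , blocked)) = M∖H-partner-of-blocked partner blocked

  no-blocked-alternating-set : ∀ {p} → Unique p → ∀ {v t} → v ∈ p → Partner H M v p → Blocked p v →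
    Settled p t → (∀ {z} → z ∈ p → z ≡ v ⊎ z ≡ t ⊎ (Partner M H z p × Partner H M z p)) → ⊥
  no-blocked-alternating-set {p} p-unique {v} {t} v∈p v-partner@(y , y∈p , vy∈H , _) v-blocked
                             t-settled kinds =
    no-M∖H-perfect-H-near-perfect-set p-unique M-partner t H-partner v∈p y∈p vy∈H
    where
    M-partner : ∀ {z} → z ∈ p → Partner M H z p
    M-partner z∈p with kinds z∈p
    ... | inj₁ refl = M∖H-partner-of-blocked v-partner v-blocked
    ... | inj₂ (inj₁ refl) = settled⇒M∖H-partner t-settled
    ... | inj₂ (inj₂ (MH , _)) = MH
    H-partner : ∀ {z} → z ∈ p → z ≢ t → ∃ λ y → y ∈ p × EdgeIn z y H
    H-partner z∈p z≢t with kinds z∈p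
    ... | inj₁ refl = y , y∈p , vy∈H
    ... | inj₂ (inj₁ z≡t) = ⊥-elim (z≢t z≡t)
    ... | inj₂ (inj₂ (_ , (y' , y'∈p , zy'∈H , _))) = y' , y'∈p , zy'∈H

  maximal-not-from-H : ∀ {p} → Unique p → Maximal M H p → ¬ AltFrom H M p
  maximal-not-from-H {x ∷ xs} p-unique max d =
    no-blocked-alternating-set p-unique (here refl) (head-partner d) head-blocked last-settled
      (λ z∈p → map₂ (map₂ Product.swap) (vertex-kinds d z∈p))
    where
    head-blocked : Blocked (x ∷ xs) x
    head-blocked w∉p xw∈M xw∉H =
      maximal-cons max w∉p p-unique (inj₁ (alt-cons d (swap xw∈M) (xw∉H ∘ swap)))
    last-settled : Settled (x ∷ xs) (last d)
    last-settled with parity d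
    ... | inj₁ (_ , partner , extend) =
      inj₂ (partner , λ s∉p ts∈M ts∉H → maximal-snoc max s∉p p-unique (inj₂ (extend ts∈M ts∉H)))
    ... | inj₂ (_ , partner , _) = inj₁ partner

  maximal-from-M-not-ending-in-H : ∀ {p} → Unique p → Maximal M H p → (d : AltFrom M H p) →
    ¬ EndsWith H M d
  maximal-from-M-not-ending-in-H {x ∷ xs} p-unique max d (partner , extend) =
    no-blocked-alternating-set p-unique (last∈ d) partner last-blocked (inj₁ (head-partner d)) kinds
    where
    kinds : ∀ {z} → z ∈ x ∷ xs → z ≡ last d ⊎ z ≡ x ⊎ (Partner M H z (x ∷ xs) × Partner H M z (x ∷ xs))
    kinds z∈p with vertex-kinds d z∈p
    ... | inj₁ z≡x = inj₂ (inj₁ z≡x)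
    ... | inj₂ (inj₁ z≡last) = inj₁ z≡last
    ... | inj₂ (inj₂ both) = inj₂ (inj₂ both)
    last-blocked : Blocked (x ∷ xs) (last d)
    last-blocked s∉p ts∈M ts∉H = maximal-snoc max s∉p p-unique (inj₁ (extend ts∈M ts∉H))

  maximal-path-odd-from-M : ∀ {p} → InP M H p →
    Σ (AltFrom M H p) λ d → OddNat (pathLength p) × EndsWith M H d
  maximal-path-odd-from-M ((p-unique , inj₂ d) , max) = ⊥-elim (maximal-not-from-H p-unique max d)
  maximal-path-odd-from-M ((p-unique , inj₁ d) , max) with parity d
  ... | inj₁ (odd , ends) = d , odd , ends
  ... | inj₂ (_ , ends) = ⊥-elim (maximal-from-M-not-ending-in-H p-unique max d ends)

  maximal-path-M∖H-partner : ∀ {p z} → InP M H p → z ∈ p → Partner M H z p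
  maximal-path-M∖H-partner {x ∷ xs} p∈P z∈p with maximal-path-odd-from-M p∈P
  ... | d , _ , last-partner , _ with vertex-kinds d z∈p
  ...   | inj₁ refl = head-partner d
  ...   | inj₂ (inj₁ refl) = last-partner
  ...   | inj₂ (inj₂ (partner , _)) = partner

corollary3 : ∀ {n} (G : SimpleGraph n) (H H' M : EdgeSet n) →
    StandingSetting G H H' M →
    (∀ (p : List (Fin n)) → InP M H p ⇔ InPoA M H p) ×
    (∀ (p : List (Fin n)) → InP M H p →
       ∀ v → v ∈ p → ∃ λ e → e ∈ H' × Incident v e)
corollary3 G H H' M st =
  (λ p → mk⇔ (λ p∈P → let d , odd , _ = maximal-path-odd-from-M p∈P in p∈P , odd , d) proj₁) ,
  λ p p∈P v v∈p → let _ , _ , vy∈M , vy∉H = maximal-path-M∖H-partner p∈P v∈p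
                  in H'-covers-M∖H-endpoint vy∈M vy∉H
  where open Standing {G = G} {H} {H'} {M} st
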